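{- Let $G^v$ and $H^w$ be finite simple rooted graphs. For any fixed nonnegative integer $k$, the sequence of independence polynomials $\bigl(I((G^v:H^w)_k^{(m)};x)\bigr)_{m\geq 0}$ satisfies a linear recurrence whose characteristic polynomial is \[ \chi(r) = \bigl(r - I(H;x)^k\bigr)\bigl(r - I(Z_k(H^w);x)\bigr). \]
   Context: All graphs are finite and simple. The independence polynomial of a graph $G$ is $I(G;x)=\sum_{i\ge 0} s_i x^i$, where $s_i$ is the number of independent sets of size $i$. A rooted graph $G^v$ is a graph with a distinguished vertex $v$. For a rooted graph $H^w$ and integer $k\ge 0$, the scale graph $Z_k(H^w)$ is obtained by taking a new vertex $v_0$ and $k$ disjoint copies of $H$ and joining $v_0$ to the root $w$ of each copy. For disjoint rooted graphs $G^v,H^w$, $(G^v:H^w)_k$ is the disjoint union of $G$ and $Z_k(H^w)$ plus the edge $vv_0$, rooted at $v$. For a sequence of nonnegative integers $i_1,\dots,i_j$, define recursively $(G^v:H^w)_{i_1,\ldots,i_j}=((G^v:H^w)_{i_1,\ldots,i_{j-1}}^v:H^w)_{i_j}$ (the empty sequence giving $G^v$), and $(G^v:H^w)_k^{(m)}=(G^v:H^w)_{k,\ldots,k}$ with $k$ repeated $m$ times. A sequence $(p_m)_{m\ge0}$ satisfies the linear recurrence with characteristic polynomial $r^n - c_{n-1}r^{n-1}-\cdots-c_0$ if $p_m = c_{n-1}p_{m-1}+\cdots+c_0p_{m-n}$ for all $m\ge n$. -}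

module Defs where

open import Data.Bool using (Bool; true; false; _∧_; not)
open import Data.Nat as ℕ using (ℕ; zero; suc; _∸_; _≤_)
open import Data.Fin as Fin using (Fin; splitAt; _↑ˡ_; _↑ʳ_)
open import Data.Sum using (_⊎_; inj₁; inj₂)
open import Data.Vec using (Vec; []; _∷_; lookup)
open import Data.List using (List; []; _∷_; map; _++_; foldr; length; filterᵇ; upTo; allFin)
open import Data.Integer as ℤ using (ℤ; +_)
open import Relation.Nullary.Decidable using (isYes)
open import Relation.Binary.PropositionalEquality using (_≡_; refl)

record Graph : Set where
  field
    n      : ℕ
    adj    : Fin n → Fin n → Bool
    sym    : ∀ u v → adj u v ≡ adj v u
    irrefl : ∀ u → adj u u ≡ false
open Graph public

record Rooted : Set where
  constructor _^_
  field
    graph : Graph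
    root  : Fin (n graph)
open Rooted public

-- Disjoint union of G and H plus the single edge a—b (a ∈ G, b ∈ H).
-- Vertices of G come first (i ↑ˡ _), then those of H (_ ↑ʳ j).

private
  _==_ : ∀ {m} → Fin m → Fin m → Bool
  i == j = isYes (i Fin.≟ j)

  jadj : (G : Graph) (a : Fin (n G)) (H : Graph) (b : Fin (n H)) →
         Fin (n G) ⊎ Fin (n H) → Fin (n G) ⊎ Fin (n H) → Bool
  jadj G a H b (inj₁ i) (inj₁ j) = adj G i j
  jadj G a H b (inj₂ i) (inj₂ j) = adj H i j
  jadj G a H b (inj₁ i) (inj₂ j) = (i == a) ∧ (j == b)
  jadj G a H b (inj₂ j) (inj₁ i) = (i == a) ∧ (j == b)

  jsym : ∀ G a H b x y → jadj G a H b x y ≡ jadj G a H b y x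
  jsym G a H b (inj₁ i) (inj₁ j) = sym G i j
  jsym G a H b (inj₂ i) (inj₂ j) = sym H i j
  jsym G a H b (inj₁ i) (inj₂ j) = refl
  jsym G a H b (inj₂ j) (inj₁ i) = refl

  jirr : ∀ G a H b x → jadj G a H b x x ≡ false
  jirr G a H b (inj₁ i) = irrefl G i
  jirr G a H b (inj₂ i) = irrefl H i

joinEdge : (G : Graph) → Fin (n G) → (H : Graph) → Fin (n H) → Graph
joinEdge G a H b = record
  { n      = n G ℕ.+ n H
  ; adj    = λ x y → jadj G a H b (splitAt (n G) x) (splitAt (n G) y)
  ; sym    = λ x y → jsym G a H b (splitAt (n G) x) (splitAt (n G) y)
  ; irrefl = λ x → jirr G a H b (splitAt (n G) x)
  }

K1 : Graph
K1 = record { n = 1 ; adj = λ _ _ → false ; sym = λ _ _ → refl ; irrefl = λ _ → refl }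

-- Scale graph Z_k(H^w), rooted at the new vertex v₀: v₀ joined to the
-- root w of each of k disjoint copies of H (copies added one at a time;
-- v₀ stays the root).

ZR : ℕ → Rooted → Rooted
ZR zero      Hw = K1 ^ Fin.zero
ZR (suc k) Hw =
  joinEdge (graph (ZR k Hw)) (root (ZR k Hw)) (graph Hw) (root Hw)
    ^ (root (ZR k Hw) ↑ˡ n (graph Hw))

Z : ℕ → Rooted → Graph
Z k Hw = graph (ZR k Hw)

colon : Rooted → Rooted → ℕ → Rooted
colon Gv Hw k =
  joinEdge (graph Gv) (root Gv) (Z k Hw) (root (ZR k Hw))
    ^ (root Gv ↑ˡ n (Z k Hw))

colonPow : Rooted → Rooted → ℕ → ℕ → Rooted
colonPow Gv Hw k zero    = Gv
colonPow Gv Hw k (suc m) = colon (colonPow Gv Hw k m) Hw k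

-- Polynomials in x with integer coefficients, represented by their
-- coefficient sequence (coefficient of x^i at i).

Poly : Set
Poly = ℕ → ℤ

infixl 6 _+ₚ_
infixl 7 _*ₚ_
infix  4 _≈ₚ_

_≈ₚ_ : Poly → Poly → Set
p ≈ₚ q = ∀ i → p i ≡ q i

_+ₚ_ : Poly → Poly → Poly
(p +ₚ q) i = p i ℤ.+ q i

-ₚ_ : Poly → Poly
(-ₚ p) i = ℤ.- p i

sumℤ : List ℤ → ℤ
sumℤ = foldr ℤ._+_ (+ 0)

_*ₚ_ : Poly → Poly → Poly
(p *ₚ q) i = sumℤ (map (λ j → p j ℤ.* q (i ∸ j)) (upTo (suc i)))

oneₚ : Poly
oneₚ zero    = + 1
oneₚ (suc _) = + 0

_^ₚ_ : Poly → ℕ → Poly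
p ^ₚ zero  = oneₚ
p ^ₚ suc k = p *ₚ (p ^ₚ k)

allSubsets : (m : ℕ) → List (Vec Bool m)
allSubsets zero    = [] ∷ []
allSubsets (suc m) = map (true ∷_) (allSubsets m) ++ map (false ∷_) (allSubsets m)

size : ∀ {m} → Vec Bool m → ℕ
size []          = 0
size (true ∷ s)  = suc (size s)
size (false ∷ s) = size s

allᵇ : ∀ {A : Set} → (A → Bool) → List A → Bool
allᵇ p = foldr (λ x b → p x ∧ b) true

independent : (G : Graph) → Vec Bool (n G) → Bool
independent G s =
  allᵇ (λ u → allᵇ (λ v → not (lookup s u ∧ lookup s v ∧ adj G u v)) (allFin (n G))) (allFin (n G))

I : Graph → Poly
I G i = + length (filterᵇ (λ s → independent G s ∧ isYes (size s ℕ.≟ i)) (allSubsets (n G)))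

-- A sequence p satisfies the linear recurrence with characteristic
-- polynomial r^d − c_{d−1} r^{d−1} − ⋯ − c_0  (c given as Fin d → Poly):
-- p_m = Σ_{j<d} c_j p_{m−d+j} for all m ≥ d.

SatisfiesRecurrence : (d : ℕ) → (Fin d → Poly) → (ℕ → Poly) → Set
SatisfiesRecurrence d c p =
  ∀ m → d ≤ m →
    p m ≈ₚ foldr _+ₚ_ (λ _ → + 0)
                 (map (λ j → c j *ₚ p ((m ∸ d) ℕ.+ Fin.toℕ j)) (allFin d))

-- coefficients of χ(r) = (r − A)(r − B) = r² − (A + B) r − (−AB)
quadCoeffs : Poly → Poly → Fin 2 → Poly
quadCoeffs A B Fin.zero       = -ₚ (A *ₚ B)
quadCoeffs A B (Fin.suc _)    = A +ₚ B

{-# OPTIONS --safe #-}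
-- Split the independent sets of G_m = (G^v:H^w)_k^{(m)} according to whether they contain
-- the root v: I(G_m) = Q_m + R_m.  Passing to G_{m+1} glues Z_k(H^w) to v by the edge v v₀.
-- A set avoiding v may be completed by any independent set of Z_k(H^w), so
-- R_{m+1} = R_m I(Z_k(H^w)); a set containing v must avoid v₀, and the independent sets of
-- Z_k(H^w) avoiding v₀ are counted by I(H)^k, so Q_{m+1} = Q_m I(H)^k.  A sum of two geometric
-- sequences with ratios A and B satisfies p_{m+2} = (A + B) p_{m+1} − AB p_m.

module Submission where

open import Defs hiding (sym)
open import Algebra.Bundles using (CommutativeRing; CommutativeSemiring)
open import Algebra.Structures using (IsCommutativeRing)
open import Data.Nat as ℕ using (ℕ; zero; suc; _∸_; s≤s)
import Data.Nat.Properties as ℕ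
open import Data.Integer as ℤ using (ℤ)
import Data.Integer.Properties as ℤ
open import Data.Integer.Tactic.RingSolver using (solve-∀)
open import Data.Bool using (Bool; true; false; _∧_; not)
open import Data.Bool.Properties
  using (∧-assoc; ∧-comm; ∧-zeroʳ; ∧-identityʳ; ∧-conicalˡ; ∧-conicalʳ; not-involutive; ⇔→≡)
open import Data.List using (List; []; _∷_; _++_; map; length; filterᵇ; upTo; applyUpTo; allFin)
open import Data.List.Properties using (map-applyUpTo; map-cong; filter-++; length-++)
open import Data.Vec as Vec using (Vec; []; _∷_; lookup)
open import Data.Vec.Properties using (lookup-++ˡ; lookup-++ʳ)
open import Data.Fin as Fin using (Fin; _↑ˡ_; _↑ʳ_; splitAt)
open import Data.Fin.Properties using (splitAt-↑ˡ; splitAt-↑ʳ; join-splitAt)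
open import Data.List.Membership.Propositional using (_∈_)
open import Data.List.Membership.Propositional.Properties using (∈-allFin)
open import Data.List.Relation.Unary.Any using (here; there)
open import Data.Sum using (inj₁; inj₂)
open import Relation.Nullary.Decidable using (isYes; isYes≗does; T?; dec-true; yes; no)
open import Data.Product using (_×_; _,_)
open import Function.Bundles using (_⇔_; mk⇔; module Equivalence)
open import Function using (_∘_; id; const)
open import Level using (0ℓ)
open import Relation.Binary.PropositionalEquality
  using (_≡_; refl; sym; trans; cong; cong₂; _≗_; _→-setoid_; module ≡-Reasoning)
import Relation.Binary.Reasoning.Setoid as ≈-Reasoning
open import Algebra.Consequences.Setoid (ℕ →-setoid ℤ) using (comm∧idˡ⇒id; comm∧distrʳ⇒distr)
import Algebra.Construct.Pointwise ℕ as Pointwise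

module _ {c ℓ} (R : CommutativeSemiring c ℓ) where

  open CommutativeSemiring R renaming (refl to ≈-refl; trans to ≈-trans)
  open import Algebra.Solver.Ring.NaturalCoefficients.Default R using (solve; _:+_; _:*_; _:=_)
  open ≈-Reasoning setoid

  geometric-sum-recurrence : ∀ {a b} {p q r : ℕ → Carrier} →
    (∀ m → p m ≈ q m + r m) → (∀ m → q (suc m) ≈ q m * a) → (∀ m → r (suc m) ≈ r m * b) →
    ∀ m → p (2 ℕ.+ m) + (a * b) * p m ≈ (a + b) * p (1 ℕ.+ m)
  geometric-sum-recurrence {a} {b} {p} {q} {r} p≈q+r q-step r-step m = begin
    p (2 ℕ.+ m) + (a * b) * p m                          ≈⟨ +-cong (p≈q+r (2 ℕ.+ m)) (*-congˡ (p≈q+r m)) ⟩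
    (q (2 ℕ.+ m) + r (2 ℕ.+ m)) + (a * b) * (q m + r m)  ≈⟨ +-congʳ (+-cong (two-steps q-step) (two-steps r-step)) ⟩
    (q m * a * a + r m * b * b) + (a * b) * (q m + r m)
      ≈⟨ solve 4 (λ a b q r → q :* a :* a :+ r :* b :* b :+ a :* b :* (q :+ r)
                           := (a :+ b) :* (q :* a :+ r :* b)) ≈-refl a b (q m) (r m) ⟩
    (a + b) * (q m * a + r m * b)                        ≈⟨ *-congˡ (+-cong (q-step m) (r-step m)) ⟨
    (a + b) * (q (1 ℕ.+ m) + r (1 ℕ.+ m))               ≈⟨ *-congˡ (p≈q+r (1 ℕ.+ m)) ⟨
    (a + b) * p (1 ℕ.+ m)                                ∎
    where
    two-steps : ∀ {c} {g : ℕ → Carrier} → (∀ m → g (suc m) ≈ g m * c) → g (2 ℕ.+ m) ≈ g m * c * c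
    two-steps g-step = ≈-trans (g-step (suc m)) (*-congʳ (g-step m))

open import Data.Integer using (0ℤ; 1ℤ; _+_; _*_; -_)

zeroₚ : Poly
zeroₚ _ = 0ℤ

tailₚ : Poly → Poly
tailₚ p i = p (suc i)

infixr 7 _·ₚ_
_·ₚ_ : ℤ → Poly → Poly
(c ·ₚ p) i = c * p i

-- Poly is the power-series ring ℤ[[x]]; each ring law is proved coefficientwise by induction
-- on the index, peeling off the leading term of the Cauchy sum with *ₚ-suc.
*ₚ-suc : ∀ p q i → (p *ₚ q) (suc i) ≡ p 0 * q (suc i) + (tailₚ p *ₚ q) i
*ₚ-suc p q i = cong (p 0 * q (suc i) +_) (cong sumℤ (begin
  map f (applyUpTo suc (suc i))  ≡⟨ map-applyUpTo suc f (suc i) ⟩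
  applyUpTo (f ∘ suc) (suc i)    ≡⟨ map-applyUpTo id (f ∘ suc) (suc i) ⟨
  map (f ∘ suc) (upTo (suc i))   ∎))
  where
  open ≡-Reasoning
  f : ℕ → ℤ
  f j = p j * q (suc i ∸ j)

*ₚ-cong : ∀ {p p′ q q′} → p ≈ₚ p′ → q ≈ₚ q′ → p *ₚ q ≈ₚ p′ *ₚ q′
*ₚ-cong p≈p′ q≈q′ i =
  cong sumℤ (map-cong (λ j → cong₂ _*_ (p≈p′ j) (q≈q′ (i ∸ j))) (upTo (suc i)))

*ₚ-zeroˡ : ∀ q → zeroₚ *ₚ q ≈ₚ zeroₚ
*ₚ-zeroˡ q zero    = cong (_+ 0ℤ) (ℤ.*-zeroˡ (q 0))
*ₚ-zeroˡ q (suc i) = begin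
  (zeroₚ *ₚ q) (suc i)             ≡⟨ *ₚ-suc zeroₚ q i ⟩
  0ℤ * q (suc i) + (zeroₚ *ₚ q) i  ≡⟨ cong₂ _+_ (ℤ.*-zeroˡ (q (suc i))) (*ₚ-zeroˡ q i) ⟩
  0ℤ                               ∎
  where open ≡-Reasoning

*ₚ-identityˡ : ∀ q → oneₚ *ₚ q ≈ₚ q
*ₚ-identityˡ q zero    = trans (ℤ.+-identityʳ _) (ℤ.*-identityˡ (q 0))
*ₚ-identityˡ q (suc i) = begin
  (oneₚ *ₚ q) (suc i)              ≡⟨ *ₚ-suc oneₚ q i ⟩
  1ℤ * q (suc i) + (zeroₚ *ₚ q) i  ≡⟨ cong₂ _+_ (ℤ.*-identityˡ (q (suc i))) (*ₚ-zeroˡ q i) ⟩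
  q (suc i) + 0ℤ                   ≡⟨ ℤ.+-identityʳ (q (suc i)) ⟩
  q (suc i)                        ∎
  where open ≡-Reasoning

*ₚ-distribʳ : ∀ r p q → (p +ₚ q) *ₚ r ≈ₚ p *ₚ r +ₚ q *ₚ r
*ₚ-distribʳ r p q zero    = distrib₀ (p 0) (q 0) (r 0)
  where
  distrib₀ : ∀ a b c → (a + b) * c + 0ℤ ≡ (a * c + 0ℤ) + (b * c + 0ℤ)
  distrib₀ = solve-∀
*ₚ-distribʳ r p q (suc i) = begin
  ((p +ₚ q) *ₚ r) (suc i)
    ≡⟨ *ₚ-suc (p +ₚ q) r i ⟩
  (p 0 + q 0) * r (suc i) + ((tailₚ p +ₚ tailₚ q) *ₚ r) i
    ≡⟨ cong ((p 0 + q 0) * r (suc i) +_) (*ₚ-distribʳ r (tailₚ p) (tailₚ q) i) ⟩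
  (p 0 + q 0) * r (suc i) + ((tailₚ p *ₚ r) i + (tailₚ q *ₚ r) i)
    ≡⟨ regroup (p 0) (q 0) (r (suc i)) _ _ ⟩
  (p 0 * r (suc i) + (tailₚ p *ₚ r) i) + (q 0 * r (suc i) + (tailₚ q *ₚ r) i)
    ≡⟨ cong₂ _+_ (*ₚ-suc p r i) (*ₚ-suc q r i) ⟨
  (p *ₚ r +ₚ q *ₚ r) (suc i) ∎
  where
  open ≡-Reasoning
  regroup : ∀ a b c d e → (a + b) * c + (d + e) ≡ (a * c + d) + (b * c + e)
  regroup = solve-∀

·ₚ-*ₚ-assoc : ∀ c p q → (c ·ₚ p) *ₚ q ≈ₚ c ·ₚ (p *ₚ q)
·ₚ-*ₚ-assoc c p q zero    = assoc₀ c (p 0) (q 0)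
  where
  assoc₀ : ∀ c a b → c * a * b + 0ℤ ≡ c * (a * b + 0ℤ)
  assoc₀ = solve-∀
·ₚ-*ₚ-assoc c p q (suc i) = begin
  ((c ·ₚ p) *ₚ q) (suc i)                         ≡⟨ *ₚ-suc (c ·ₚ p) q i ⟩
  c * p 0 * q (suc i) + ((c ·ₚ tailₚ p) *ₚ q) i   ≡⟨ cong (c * p 0 * q (suc i) +_) (·ₚ-*ₚ-assoc c (tailₚ p) q i) ⟩
  c * p 0 * q (suc i) + c * (tailₚ p *ₚ q) i      ≡⟨ factor c (p 0) (q (suc i)) _ ⟩
  c * (p 0 * q (suc i) + (tailₚ p *ₚ q) i)        ≡⟨ cong (c *_) (*ₚ-suc p q i) ⟨
  c * (p *ₚ q) (suc i)                            ∎
  where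
  open ≡-Reasoning
  factor : ∀ c a b d → c * a * b + c * d ≡ c * (a * b + d)
  factor = solve-∀

*ₚ-comm : ∀ p q → p *ₚ q ≈ₚ q *ₚ p
*ₚ-comm p q zero          = comm₀ (p 0) (q 0)
  where
  comm₀ : ∀ a b → a * b + 0ℤ ≡ b * a + 0ℤ
  comm₀ = solve-∀
*ₚ-comm p q (suc zero)    = comm₁ (p 0) (q 1) (p 1) (q 0)
  where
  comm₁ : ∀ a b c d → a * b + (c * d + 0ℤ) ≡ d * c + (b * a + 0ℤ)
  comm₁ = solve-∀
*ₚ-comm p q (suc (suc i)) = begin
  (p *ₚ q) (2 ℕ.+ i)                  ≡⟨ *ₚ-suc p q (suc i) ⟩
  pq + (tailₚ p *ₚ q) (suc i)         ≡⟨ cong (pq +_) (*ₚ-comm (tailₚ p) q (suc i)) ⟩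
  pq + (q *ₚ tailₚ p) (suc i)         ≡⟨ cong (pq +_) (*ₚ-suc q (tailₚ p) i) ⟩
  pq + (qp + (tailₚ q *ₚ tailₚ p) i)  ≡⟨ cong (λ z → pq + (qp + z)) (*ₚ-comm (tailₚ q) (tailₚ p) i) ⟩
  pq + (qp + (tailₚ p *ₚ tailₚ q) i)  ≡⟨ swap pq qp _ ⟩
  qp + (pq + (tailₚ p *ₚ tailₚ q) i)  ≡⟨ cong (qp +_) (*ₚ-suc p (tailₚ q) i) ⟨
  qp + (p *ₚ tailₚ q) (suc i)         ≡⟨ cong (qp +_) (*ₚ-comm p (tailₚ q) (suc i)) ⟩
  qp + (tailₚ q *ₚ p) (suc i)         ≡⟨ *ₚ-suc q p (suc i) ⟨
  (q *ₚ p) (2 ℕ.+ i)                  ∎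
  where
  open ≡-Reasoning
  pq qp : ℤ
  pq = p 0 * q (2 ℕ.+ i)
  qp = q 0 * p (2 ℕ.+ i)
  swap : ∀ a b c → a + (b + c) ≡ b + (a + c)
  swap = solve-∀

*ₚ-assoc : ∀ p q r → (p *ₚ q) *ₚ r ≈ₚ p *ₚ (q *ₚ r)
*ₚ-assoc p q r zero    = assoc₀ (p 0) (q 0) (r 0)
  where
  assoc₀ : ∀ a b c → (a * b + 0ℤ) * c + 0ℤ ≡ a * (b * c + 0ℤ) + 0ℤ
  assoc₀ = solve-∀
*ₚ-assoc p q r (suc i) = begin
  ((p *ₚ q) *ₚ r) (suc i)
    ≡⟨ *ₚ-suc (p *ₚ q) r i ⟩
  pq₀r + (tailₚ (p *ₚ q) *ₚ r) i
    ≡⟨ cong (pq₀r +_) (*ₚ-cong {q = r} (*ₚ-suc p q) (λ _ → refl) i) ⟩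
  pq₀r + ((p 0 ·ₚ tailₚ q +ₚ tailₚ p *ₚ q) *ₚ r) i
    ≡⟨ cong (pq₀r +_) (*ₚ-distribʳ r (p 0 ·ₚ tailₚ q) (tailₚ p *ₚ q) i) ⟩
  pq₀r + (((p 0 ·ₚ tailₚ q) *ₚ r) i + ((tailₚ p *ₚ q) *ₚ r) i)
    ≡⟨ cong (pq₀r +_) (cong₂ _+_ (·ₚ-*ₚ-assoc (p 0) (tailₚ q) r i) (*ₚ-assoc (tailₚ p) q r i)) ⟩
  pq₀r + (p 0 * (tailₚ q *ₚ r) i + (tailₚ p *ₚ (q *ₚ r)) i)
    ≡⟨ regroup (p 0) (q 0) (r (suc i)) _ _ ⟩
  p 0 * (q 0 * r (suc i) + (tailₚ q *ₚ r) i) + (tailₚ p *ₚ (q *ₚ r)) i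
    ≡⟨ cong (λ z → p 0 * z + (tailₚ p *ₚ (q *ₚ r)) i) (*ₚ-suc q r i) ⟨
  p 0 * (q *ₚ r) (suc i) + (tailₚ p *ₚ (q *ₚ r)) i
    ≡⟨ *ₚ-suc p (q *ₚ r) i ⟨
  (p *ₚ (q *ₚ r)) (suc i) ∎
  where
  open ≡-Reasoning
  pq₀r : ℤ
  pq₀r = (p *ₚ q) 0 * r (suc i)
  regroup : ∀ a b c d e → (a * b + 0ℤ) * c + (a * d + e) ≡ a * (b * c + d) + e
  regroup = solve-∀

poly-isCommutativeRing : IsCommutativeRing _≈ₚ_ _+ₚ_ _*ₚ_ -ₚ_ zeroₚ oneₚ
poly-isCommutativeRing = record
  { isRing = record
    { +-isAbelianGroup = Pointwise.isAbelianGroup ℤ.+-0-isAbelianGroup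
    ; *-cong           = *ₚ-cong
    ; *-assoc          = *ₚ-assoc
    ; *-identity       = comm∧idˡ⇒id *ₚ-comm *ₚ-identityˡ
    ; distrib          = comm∧distrʳ⇒distr (λ p≈q r≈s i → cong₂ _+_ (p≈q i) (r≈s i)) *ₚ-comm *ₚ-distribʳ
    }
  ; *-comm = *ₚ-comm
  }

poly-commutativeRing : CommutativeRing 0ℓ 0ℓ
poly-commutativeRing = record { isCommutativeRing = poly-isCommutativeRing }

shiftₚ : Poly → Poly
shiftₚ p zero    = 0ℤ
shiftₚ p (suc i) = p i

*ₚ-shiftˡ : ∀ p q → shiftₚ p *ₚ q ≈ₚ shiftₚ (p *ₚ q)
*ₚ-shiftˡ p q zero    = refl
*ₚ-shiftˡ p q (suc i) = begin
  (shiftₚ p *ₚ q) (suc i)      ≡⟨ *ₚ-suc (shiftₚ p) q i ⟩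
  0ℤ * q (suc i) + (p *ₚ q) i  ≡⟨ cong (_+ (p *ₚ q) i) (ℤ.*-zeroˡ (q (suc i))) ⟩
  0ℤ + (p *ₚ q) i              ≡⟨ ℤ.+-identityˡ _ ⟩
  (p *ₚ q) i                   ∎
  where open ≡-Reasoning

shiftₚ-cong : ∀ {p q} → p ≈ₚ q → shiftₚ p ≈ₚ shiftₚ q
shiftₚ-cong p≈q zero    = refl
shiftₚ-cong p≈q (suc i) = p≈q i

open CommutativeRing poly-commutativeRing
  using (+-cong; +-congʳ; *-congˡ; *-congʳ; *-comm; *-identityˡ; zeroˡ; distribʳ)
  renaming (setoid to poly-setoid; commutativeSemiring to poly-commutativeSemiring)

quadCoeffs-recurrence : ∀ A B (p : ℕ → Poly) →
  (∀ m → p (2 ℕ.+ m) +ₚ (A *ₚ B) *ₚ p m ≈ₚ (A +ₚ B) *ₚ p (1 ℕ.+ m)) →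
  SatisfiesRecurrence 2 (quadCoeffs A B) p
quadCoeffs-recurrence A B p rec (suc zero) (s≤s ())
quadCoeffs-recurrence A B p rec (suc (suc m)) _ i rewrite ℕ.+-identityʳ m | ℕ.+-comm m 1 = begin
  p (2 ℕ.+ m) i
    ≡⟨ move (p (2 ℕ.+ m) i) (((A *ₚ B) *ₚ p m) i) ⟩
  - ((A *ₚ B) *ₚ p m) i + ((p (2 ℕ.+ m) +ₚ (A *ₚ B) *ₚ p m) i + 0ℤ)
    ≡⟨ cong₂ (λ x y → x + (y + 0ℤ)) (-‿distribˡ-* (A *ₚ B) (p m) i) (rec m i) ⟩
  ((-ₚ (A *ₚ B)) *ₚ p m) i + (((A +ₚ B) *ₚ p (1 ℕ.+ m)) i + 0ℤ) ∎
  where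
  open ≡-Reasoning
  open import Algebra.Properties.Ring (CommutativeRing.ring poly-commutativeRing) using (-‿distribˡ-*)
  move : ∀ x y → x ≡ - y + ((x + y) + 0ℤ)
  move = solve-∀

countᵇ : {A : Set} → (A → Bool) → List A → ℕ
countᵇ p xs = length (filterᵇ p xs)

module _ {A : Set} where

  countᵇ-cong : ∀ {p q : A → Bool} → p ≗ q → ∀ xs → countᵇ p xs ≡ countᵇ q xs
  countᵇ-cong         p≗q []       = refl
  countᵇ-cong {p} {q} p≗q (x ∷ xs) with p x | q x | p≗q x
  ... | true  | .true  | refl = cong suc (countᵇ-cong p≗q xs)
  ... | false | .false | refl = countᵇ-cong p≗q xs

  countᵇ-none : ∀ {p : A → Bool} → (∀ x → p x ≡ false) → ∀ xs → countᵇ p xs ≡ 0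
  countᵇ-none     p≡false []       = refl
  countᵇ-none {p} p≡false (x ∷ xs) with p x | p≡false x
  ... | false | refl = countᵇ-none p≡false xs

  countᵇ-++ : ∀ (p : A → Bool) xs ys → countᵇ p (xs ++ ys) ≡ countᵇ p xs ℕ.+ countᵇ p ys
  countᵇ-++ p xs ys = trans (cong length (filter-++ (T? ∘ p) xs ys)) (length-++ (filterᵇ p xs))

  countᵇ-map : ∀ {B : Set} (p : B → Bool) (f : A → B) xs → countᵇ p (map f xs) ≡ countᵇ (p ∘ f) xs
  countᵇ-map p f []       = refl
  countᵇ-map p f (x ∷ xs) with p (f x)
  ... | true  = cong suc (countᵇ-map p f xs)
  ... | false = countᵇ-map p f xs

  countᵇ-split : ∀ (p q : A → Bool) xs →
    countᵇ p xs ≡ countᵇ (λ x → p x ∧ q x) xs ℕ.+ countᵇ (λ x → p x ∧ not (q x)) xs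
  countᵇ-split p q []       = refl
  countᵇ-split p q (x ∷ xs) with p x | q x
  ... | true  | true  = cong suc (countᵇ-split p q xs)
  ... | true  | false = trans (cong suc (countᵇ-split p q xs)) (sym (ℕ.+-suc _ _))
  ... | false | _     = countᵇ-split p q xs

-- Σ_{s with P s} x^|s|, so that I G is subsetPoly (independent G) by definition.
subsetPoly : ∀ {m} → (Vec Bool m → Bool) → Poly
subsetPoly {m} P i = ℤ.+ countᵇ (λ s → P s ∧ isYes (size s ℕ.≟ i)) (allSubsets m)

module _ {m : ℕ} where

  subsetPoly-cong : ∀ {P Q : Vec Bool m → Bool} → P ≗ Q → subsetPoly P ≈ₚ subsetPoly Q
  subsetPoly-cong P≗Q i =
    cong ℤ.+_ (countᵇ-cong (λ s → cong (_∧ isYes (size s ℕ.≟ i)) (P≗Q s)) (allSubsets m))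

  subsetPoly-split : ∀ (P Q : Vec Bool m → Bool) →
    subsetPoly P ≈ₚ subsetPoly (λ s → P s ∧ Q s) +ₚ subsetPoly (λ s → P s ∧ not (Q s))
  subsetPoly-split P Q i = trans
    (cong ℤ.+_ (trans (countᵇ-split _ Q (allSubsets m))
                      (cong₂ ℕ._+_ (countᵇ-cong (λ s → swap (P s) _ (Q s)) (allSubsets m))
                                   (countᵇ-cong (λ s → swap (P s) _ (not (Q s))) (allSubsets m)))))
    (ℤ.pos-+ (count (λ s → P s ∧ Q s)) (count (λ s → P s ∧ not (Q s))))
    where
    count : (Vec Bool m → Bool) → ℕ
    count R = countᵇ (λ s → R s ∧ isYes (size s ℕ.≟ i)) (allSubsets m)
    swap : ∀ x y z → (x ∧ y) ∧ z ≡ (x ∧ z) ∧ y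
    swap x y z = trans (∧-assoc x y z) (trans (cong (x ∧_) (∧-comm y z)) (sym (∧-assoc x z y)))

subsetPoly-suc : ∀ {m} (P : Vec Bool (suc m) → Bool) →
  subsetPoly P ≈ₚ shiftₚ (subsetPoly (P ∘ (true ∷_))) +ₚ subsetPoly (P ∘ (false ∷_))
subsetPoly-suc {m} P i = begin
  subsetPoly P i
    ≡⟨ cong ℤ.+_ (countᵇ-++ sized (map (true ∷_) S) (map (false ∷_) S)) ⟩
  ℤ.+ (countᵇ sized (map (true ∷_) S) ℕ.+ countᵇ sized (map (false ∷_) S))
    ≡⟨ cong ℤ.+_ (cong₂ ℕ._+_ (countᵇ-map sized (true ∷_) S) (countᵇ-map sized (false ∷_) S)) ⟩
  ℤ.+ (countᵇ (sized ∘ (true ∷_)) S ℕ.+ countᵇ (sized ∘ (false ∷_)) S)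
    ≡⟨ ℤ.pos-+ (countᵇ (sized ∘ (true ∷_)) S) (countᵇ (sized ∘ (false ∷_)) S) ⟩
  ℤ.+ countᵇ (sized ∘ (true ∷_)) S + subsetPoly (P ∘ (false ∷_)) i
    ≡⟨ cong (_+ subsetPoly (P ∘ (false ∷_)) i) (shifted i) ⟩
  shiftₚ (subsetPoly (P ∘ (true ∷_))) i + subsetPoly (P ∘ (false ∷_)) i ∎
  where
  open ≡-Reasoning
  S : List (Vec Bool m)
  S = allSubsets m
  sized : Vec Bool (suc m) → Bool
  sized s = P s ∧ isYes (size s ℕ.≟ i)
  shifted : ∀ i → ℤ.+ countᵇ (λ s → P (true ∷ s) ∧ isYes (suc (size s) ℕ.≟ i)) S
                ≡ shiftₚ (subsetPoly (P ∘ (true ∷_))) i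
  shifted zero    = cong ℤ.+_ (countᵇ-none (λ s → ∧-zeroʳ (P (true ∷ s))) S)
  shifted (suc j) = cong ℤ.+_ (countᵇ-cong (λ s → cong (P (true ∷ s) ∧_) (isYes-suc (size s))) S)
    where
    isYes-suc : ∀ x → isYes (suc x ℕ.≟ suc j) ≡ isYes (x ℕ.≟ j)
    isYes-suc x = trans (isYes≗does (suc x ℕ.≟ suc j)) (sym (isYes≗does (x ℕ.≟ j)))

subsetPoly-++ : ∀ m {k} {R : Vec Bool (m ℕ.+ k) → Bool} {P : Vec Bool m → Bool} {Q : Vec Bool k → Bool} →
  (∀ s t → R (s Vec.++ t) ≡ P s ∧ Q t) → subsetPoly R ≈ₚ subsetPoly P *ₚ subsetPoly Q
subsetPoly-++ zero {k} {R} {P} {Q} R≡ = begin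
  subsetPoly R                                   ≈⟨ subsetPoly-cong (R≡ []) ⟩
  subsetPoly (λ t → P [] ∧ Q t)                  ≈⟨ scale (P []) ⟩
  subsetPoly {0} (const (P [])) *ₚ subsetPoly Q  ≈⟨ *-congʳ {subsetPoly Q} (subsetPoly-cong P[]≗P) ⟩
  subsetPoly P *ₚ subsetPoly Q                   ∎
  where
  open ≈-Reasoning poly-setoid
  one : subsetPoly {0} (const true) ≈ₚ oneₚ
  one zero    = refl
  one (suc i) = refl
  scale : ∀ b → subsetPoly (λ t → b ∧ Q t) ≈ₚ subsetPoly {0} (const b) *ₚ subsetPoly Q
  scale true  i = sym (trans (*-congʳ {subsetPoly Q} one i) (*-identityˡ (subsetPoly Q) i))
  scale false i = trans (cong ℤ.+_ (countᵇ-none (λ _ → refl) (allSubsets k))) (sym (zeroˡ (subsetPoly Q) i))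
  P[]≗P : const (P []) ≗ P
  P[]≗P [] = refl
subsetPoly-++ (suc m) {R = R} {P} {Q} R≡ = begin
  subsetPoly R
    ≈⟨ subsetPoly-suc R ⟩
  shiftₚ (subsetPoly (R ∘ (true ∷_))) +ₚ subsetPoly (R ∘ (false ∷_))
    ≈⟨ +-cong (shiftₚ-cong (subsetPoly-++ m (R≡ ∘ (true ∷_)))) (subsetPoly-++ m (R≡ ∘ (false ∷_))) ⟩
  shiftₚ (subsetPoly P₁ *ₚ subsetPoly Q) +ₚ subsetPoly P₀ *ₚ subsetPoly Q
    ≈⟨ +-congʳ {subsetPoly P₀ *ₚ subsetPoly Q} (*ₚ-shiftˡ (subsetPoly P₁) (subsetPoly Q)) ⟨
  shiftₚ (subsetPoly P₁) *ₚ subsetPoly Q +ₚ subsetPoly P₀ *ₚ subsetPoly Q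
    ≈⟨ distribʳ (subsetPoly Q) (shiftₚ (subsetPoly P₁)) (subsetPoly P₀) ⟨
  (shiftₚ (subsetPoly P₁) +ₚ subsetPoly P₀) *ₚ subsetPoly Q
    ≈⟨ *-congʳ {subsetPoly Q} (subsetPoly-suc P) ⟨
  subsetPoly P *ₚ subsetPoly Q ∎
  where
  open ≈-Reasoning poly-setoid
  P₁ P₀ : Vec Bool m → Bool
  P₁ = P ∘ (true ∷_)
  P₀ = P ∘ (false ∷_)

module _ {A : Set} (p : A → Bool) where

  allᵇ-true : (∀ x → p x ≡ true) → ∀ xs → allᵇ p xs ≡ true
  allᵇ-true p≡true []       = refl
  allᵇ-true p≡true (x ∷ xs) = cong₂ _∧_ (p≡true x) (allᵇ-true p≡true xs)

  allᵇ-true⁻ : ∀ {xs} → allᵇ p xs ≡ true → ∀ {x} → x ∈ xs → p x ≡ true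
  allᵇ-true⁻ {y ∷ xs} all≡true (here refl) = ∧-conicalˡ (p y) _ all≡true
  allᵇ-true⁻ {y ∷ xs} all≡true (there x∈xs) = allᵇ-true⁻ (∧-conicalʳ (p y) _ all≡true) x∈xs

clash : (G : Graph) → Vec Bool (n G) → Fin (n G) → Fin (n G) → Bool
clash G s u v = lookup s u ∧ lookup s v ∧ adj G u v

Independent : (G : Graph) → Vec Bool (n G) → Set
Independent G s = ∀ u v → clash G s u v ≡ false

not-true : ∀ {x} → not x ≡ true → x ≡ false
not-true {x} not-x≡true = trans (sym (not-involutive x)) (cong not not-x≡true)

independent⇔Independent : ∀ G s → independent G s ≡ true ⇔ Independent G s
independent⇔Independent G s = mk⇔
  (λ ind u v → not-true (allᵇ-true⁻ _ (allᵇ-true⁻ _ ind (∈-allFin u)) (∈-allFin v)))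
  (λ ind → allᵇ-true _ (λ u → allᵇ-true _ (λ v → cong not (ind u v)) (allFin (n G))) (allFin (n G)))

clash-sym : ∀ G s u v → clash G s u v ≡ clash G s v u
clash-sym G s u v with lookup s u | lookup s v
... | true  | true  = Graph.sym G u v
... | true  | false = refl
... | false | true  = refl
... | false | false = refl

↑-elim : ∀ m {k} {P : Fin (m ℕ.+ k) → Set} → (∀ u → P (u ↑ˡ k)) → (∀ v → P (m ↑ʳ v)) → ∀ x → P x
↑-elim m {k} P↑ˡ P↑ʳ x with splitAt m x | join-splitAt m k x
... | inj₁ u | refl = P↑ˡ u
... | inj₂ v | refl = P↑ʳ v

module _ (G : Graph) (a : Fin (n G)) (H : Graph) (b : Fin (n H)) (s : Vec Bool (n G)) (t : Vec Bool (n H)) where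

  private
    J = joinEdge G a H b

  clash-↑ˡ-↑ˡ : ∀ u v → clash J (s Vec.++ t) (u ↑ˡ n H) (v ↑ˡ n H) ≡ clash G s u v
  clash-↑ˡ-↑ˡ u v = cong₂ _∧_ (lookup-++ˡ s t u) (cong₂ _∧_ (lookup-++ˡ s t v) adj≡)
    where
    adj≡ : adj J (u ↑ˡ n H) (v ↑ˡ n H) ≡ adj G u v
    adj≡ rewrite splitAt-↑ˡ (n G) u (n H) | splitAt-↑ˡ (n G) v (n H) = refl

  clash-↑ʳ-↑ʳ : ∀ u v → clash J (s Vec.++ t) (n G ↑ʳ u) (n G ↑ʳ v) ≡ clash H t u v
  clash-↑ʳ-↑ʳ u v = cong₂ _∧_ (lookup-++ʳ s t u) (cong₂ _∧_ (lookup-++ʳ s t v) adj≡)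
    where
    adj≡ : adj J (n G ↑ʳ u) (n G ↑ʳ v) ≡ adj H u v
    adj≡ rewrite splitAt-↑ʳ (n G) (n H) u | splitAt-↑ʳ (n G) (n H) v = refl

  clash-↑ˡ-↑ʳ : ∀ u v → clash J (s Vec.++ t) (u ↑ˡ n H) (n G ↑ʳ v)
                      ≡ lookup s u ∧ lookup t v ∧ (isYes (u Fin.≟ a) ∧ isYes (v Fin.≟ b))
  clash-↑ˡ-↑ʳ u v = cong₂ _∧_ (lookup-++ˡ s t u) (cong₂ _∧_ (lookup-++ʳ s t v) adj≡)
    where
    adj≡ : adj J (u ↑ˡ n H) (n G ↑ʳ v) ≡ isYes (u Fin.≟ a) ∧ isYes (v Fin.≟ b)
    adj≡ rewrite splitAt-↑ˡ (n G) u (n H) | splitAt-↑ʳ (n G) (n H) v = refl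

  Independent-joinEdge⇔ : Independent J (s Vec.++ t) ⇔
    (Independent G s × Independent H t × lookup s a ∧ lookup t b ≡ false)
  Independent-joinEdge⇔ = mk⇔
    (λ ind → (λ u v → trans (sym (clash-↑ˡ-↑ˡ u v)) (ind _ _))
           , (λ u v → trans (sym (clash-↑ʳ-↑ʳ u v)) (ind _ _))
           , trans (sym (endpoints (lookup s a) (lookup t b))) (trans (sym (clash-↑ˡ-↑ʳ a b)) (ind _ _)))
    (λ (indG , indH , not-both) → ↑-elim (n G)
      (λ u → ↑-elim (n G) (λ v → trans (clash-↑ˡ-↑ˡ u v) (indG u v))
                          (λ v → trans (clash-↑ˡ-↑ʳ u v) (cross not-both u v)))
      (λ u → ↑-elim (n G) (λ v → trans (clash-sym J (s Vec.++ t) (n G ↑ʳ u) (v ↑ˡ n H))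
                                       (trans (clash-↑ˡ-↑ʳ v u) (cross not-both v u)))
                          (λ v → trans (clash-↑ʳ-↑ʳ u v) (indH u v))))
    where
    endpoints : ∀ x y → x ∧ y ∧ (isYes (a Fin.≟ a) ∧ isYes (b Fin.≟ b)) ≡ x ∧ y
    endpoints x y rewrite isYes≗does (a Fin.≟ a) | dec-true (a Fin.≟ a) refl
                        | isYes≗does (b Fin.≟ b) | dec-true (b Fin.≟ b) refl
                        = cong (x ∧_) (∧-identityʳ y)
    cross : lookup s a ∧ lookup t b ≡ false →
            ∀ u v → lookup s u ∧ lookup t v ∧ (isYes (u Fin.≟ a) ∧ isYes (v Fin.≟ b)) ≡ false
    cross not-both u v with u Fin.≟ a | v Fin.≟ b
    ... | yes refl | yes refl = trans (cong (lookup s a ∧_) (∧-identityʳ (lookup t b))) not-both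
    ... | yes _    | no _     = trans (cong (lookup s u ∧_) (∧-zeroʳ (lookup t v))) (∧-zeroʳ (lookup s u))
    ... | no _     | _        = trans (cong (lookup s u ∧_) (∧-zeroʳ (lookup t v))) (∧-zeroʳ (lookup s u))

  independent-joinEdge : independent J (s Vec.++ t)
                       ≡ (independent G s ∧ independent H t) ∧ not (lookup s a ∧ lookup t b)
  independent-joinEdge = ⇔→≡ (mk⇔ to′ from′)
    where
    open Equivalence
    joined : Bool
    joined = (independent G s ∧ independent H t) ∧ not (lookup s a ∧ lookup t b)
    to′ : independent J (s Vec.++ t) ≡ true → joined ≡ true
    to′ ind with indG , indH , not-both ← to Independent-joinEdge⇔ (to (independent⇔Independent J (s Vec.++ t)) ind)
      = cong₂ _∧_ (cong₂ _∧_ (from (independent⇔Independent G s) indG) (from (independent⇔Independent H t) indH))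
                  (cong not not-both)
    from′ : joined ≡ true → independent J (s Vec.++ t) ≡ true
    from′ joined≡true = from (independent⇔Independent J (s Vec.++ t)) (from Independent-joinEdge⇔
      ( to (independent⇔Independent G s) (∧-conicalˡ _ _ both)
      , to (independent⇔Independent H t) (∧-conicalʳ _ _ both)
      , not-true (∧-conicalʳ _ _ joined≡true)))
      where
      both : independent G s ∧ independent H t ≡ true
      both = ∧-conicalˡ _ _ joined≡true

Iin Iout : (G : Graph) → Fin (n G) → Poly
Iin  G a = subsetPoly (λ s → independent G s ∧ lookup s a)
Iout G a = subsetPoly (λ s → independent G s ∧ not (lookup s a))

I≈Iin+Iout : ∀ G a → I G ≈ₚ Iin G a +ₚ Iout G a
I≈Iin+Iout G a = subsetPoly-split (independent G) (λ s → lookup s a)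

module _ (G : Graph) (a : Fin (n G)) (H : Graph) (b : Fin (n H)) where

  Iin-joinEdge : Iin (joinEdge G a H b) (a ↑ˡ n H) ≈ₚ Iin G a *ₚ Iout H b
  Iin-joinEdge = subsetPoly-++ (n G) λ s t →
    trans (cong₂ _∧_ (independent-joinEdge G a H b s t) (lookup-++ˡ s t a))
          (rearrange (independent G s) (independent H t) (lookup s a) (lookup t b))
    where
    rearrange : ∀ x y p q → ((x ∧ y) ∧ not (p ∧ q)) ∧ p ≡ (x ∧ p) ∧ (y ∧ not q)
    rearrange x y true  q =
      trans (∧-identityʳ _) (trans (∧-assoc x y (not q)) (cong (_∧ (y ∧ not q)) (sym (∧-identityʳ x))))
    rearrange x y false q = trans (∧-zeroʳ _) (cong (_∧ (y ∧ not q)) (sym (∧-zeroʳ x)))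

  Iout-joinEdge : Iout (joinEdge G a H b) (a ↑ˡ n H) ≈ₚ Iout G a *ₚ I H
  Iout-joinEdge = subsetPoly-++ (n G) λ s t →
    trans (cong₂ (λ x y → x ∧ not y) (independent-joinEdge G a H b s t) (lookup-++ˡ s t a))
          (rearrange (independent G s) (independent H t) (lookup s a) (lookup t b))
    where
    rearrange : ∀ x y p q → ((x ∧ y) ∧ not (p ∧ q)) ∧ not p ≡ (x ∧ not p) ∧ y
    rearrange x y true  q = trans (∧-zeroʳ _) (cong (_∧ y) (sym (∧-zeroʳ x)))
    rearrange x y false q = trans (∧-identityʳ _) (trans (∧-identityʳ _) (cong (_∧ y) (sym (∧-identityʳ x))))

Iout-Z : ∀ k Hw → Iout (Z k Hw) (root (ZR k Hw)) ≈ₚ I (graph Hw) ^ₚ k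
Iout-Z zero    Hw zero    = refl
Iout-Z zero    Hw (suc i) = refl
Iout-Z (suc k) Hw = begin
  Iout (Z (suc k) Hw) (root (ZR (suc k) Hw))   ≈⟨ Iout-joinEdge (Z k Hw) (root (ZR k Hw)) (graph Hw) (root Hw) ⟩
  Iout (Z k Hw) (root (ZR k Hw)) *ₚ I (graph Hw) ≈⟨ *-congʳ {I (graph Hw)} (Iout-Z k Hw) ⟩
  I (graph Hw) ^ₚ k *ₚ I (graph Hw)             ≈⟨ *-comm (I (graph Hw) ^ₚ k) (I (graph Hw)) ⟩
  I (graph Hw) ^ₚ suc k                          ∎
  where open ≈-Reasoning poly-setoid

theorem2p3 : (Gv Hw : Rooted) (k : ℕ) →
    SatisfiesRecurrence 2
    (quadCoeffs (I (graph Hw) ^ₚ k) (I (Z k Hw)))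
    (λ m → I (graph (colonPow Gv Hw k m)))
theorem2p3 Gv Hw k = quadCoeffs-recurrence A B P
  (geometric-sum-recurrence poly-commutativeSemiring {A} {B} {P} {Q} {R} P≈Q+R Q-step R-step)
  where
  G : ℕ → Rooted
  G = colonPow Gv Hw k
  A B : Poly
  A = I (graph Hw) ^ₚ k
  B = I (Z k Hw)
  P Q R : ℕ → Poly
  P m = I (graph (G m))
  Q m = Iin (graph (G m)) (root (G m))
  R m = Iout (graph (G m)) (root (G m))
  P≈Q+R : ∀ m → P m ≈ₚ Q m +ₚ R m
  P≈Q+R m = I≈Iin+Iout (graph (G m)) (root (G m))
  Q-step : ∀ m → Q (suc m) ≈ₚ Q m *ₚ A
  Q-step m i = trans (Iin-joinEdge (graph (G m)) (root (G m)) (Z k Hw) (root (ZR k Hw)) i)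
                     (*-congˡ {Q m} (Iout-Z k Hw) i)
  R-step : ∀ m → R (suc m) ≈ₚ R m *ₚ B
  R-step m = Iout-joinEdge (graph (G m)) (root (G m)) (Z k Hw) (root (ZR k Hw))
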